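{- Let $\mathsf{X}$ be any set of axiom schemata and let $\Gamma$ be a maximal $\mathbf{IL X}$-consistent set with $\neg(A\rhd B)\in\Gamma$. Then there exists a maximal $\mathbf{IL X}$-consistent set $\Delta$ such that $\Gamma\prec_B\Delta$ and $A,\Box\neg A\in\Delta$.
   Context: $\mathbf{IL}$ is the interpretability logic in the language with $\bot,\rightarrow,\Box,\rhd$ ($\Diamond=\neg\Box\neg$), axiomatized by tautologies, $\Box(A\rightarrow B)\rightarrow(\Box A\rightarrow\Box B)$, $\Box A\rightarrow\Box\Box A$, $\Box(\Box A\rightarrow A)\rightarrow\Box A$, $\Box(A\rightarrow B)\rightarrow A\rhd B$, $(A\rhd B)\wedge(B\rhd C)\rightarrow A\rhd C$, $(A\rhd C)\wedge(B\rhd C)\rightarrow A\vee B\rhd C$, $A\rhd B\rightarrow(\Diamond A\rightarrow\Diamond B)$, $\Diamond A\rhd A$, with modus ponens and necessitation; $\mathbf{IL X}$ adds all instances of the schemata in $\mathsf{X}$. Maximal consistent sets are defined w.r.t. derivability using theorems of $\mathbf{IL X}$ and modus ponens. For maximal consistent sets, $\Gamma\prec_C\Delta$ iff for all $E$, $E\rhd C\in\Gamma$ implies $\neg E,\Box\neg E\in\Delta$. -}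

module Defs where

open import Data.Nat using (ℕ)
open import Data.Bool using (Bool; true; false; not; _∨_)
open import Data.Product using (Σ; _×_)
open import Relation.Binary.PropositionalEquality using (_≡_)
open import Relation.Nullary using (¬_)

infixr 6 _⇒_
infix 7 _▷_
data Fm : Set where
  var : ℕ → Fm
  ⊥'  : Fm
  _⇒_ : Fm → Fm → Fm
  □   : Fm → Fm
  _▷_ : Fm → Fm → Fm

~_ : Fm → Fm
~ A = A ⇒ ⊥'

◇ : Fm → Fm
◇ A = ~ □ (~ A)

_∨'_ : Fm → Fm → Fm
A ∨' B = (~ A) ⇒ B

_∧'_ : Fm → Fm → Fm
A ∧' B = ~ (A ⇒ ~ B)

eval : (Fm → Bool) → Fm → Bool
eval v (var p) = v (var p)
eval v ⊥' = false
eval v (A ⇒ B) = not (eval v A) ∨ eval v B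
eval v (□ A) = v (□ A)
eval v (A ▷ B) = v (A ▷ B)

Taut : Fm → Set
Taut A = (v : Fm → Bool) → eval v A ≡ true

sub : (ℕ → Fm) → Fm → Fm
sub σ (var p) = σ p
sub σ ⊥' = ⊥'
sub σ (A ⇒ B) = sub σ A ⇒ sub σ B
sub σ (□ A) = □ (sub σ A)
sub σ (A ▷ B) = sub σ A ▷ sub σ B

-- A set of axiom schemata X is a set of formulas (schemata, whose variables
-- are the metavariables); its instances are all substitution instances.
Schemata : Set₁
Schemata = Fm → Set

data ILX⊢ (X : Schemata) : Fm → Set where
  taut : ∀ {A} → Taut A → ILX⊢ X A
  K    : ∀ {A B} → ILX⊢ X (□ (A ⇒ B) ⇒ (□ A ⇒ □ B))
  four : ∀ {A} → ILX⊢ X (□ A ⇒ □ (□ A))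
  L    : ∀ {A} → ILX⊢ X (□ (□ A ⇒ A) ⇒ □ A)
  J1   : ∀ {A B} → ILX⊢ X (□ (A ⇒ B) ⇒ (A ▷ B))
  J2   : ∀ {A B C} → ILX⊢ X (((A ▷ B) ∧' (B ▷ C)) ⇒ (A ▷ C))
  J3   : ∀ {A B C} → ILX⊢ X (((A ▷ C) ∧' (B ▷ C)) ⇒ ((A ∨' B) ▷ C))
  J4   : ∀ {A B} → ILX⊢ X ((A ▷ B) ⇒ (◇ A ⇒ ◇ B))
  J5   : ∀ {A} → ILX⊢ X (◇ A ▷ A)
  inst : ∀ {S} → X S → (σ : ℕ → Fm) → ILX⊢ X (sub σ S)
  mp   : ∀ {A B} → ILX⊢ X (A ⇒ B) → ILX⊢ X A → ILX⊢ X B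
  nec  : ∀ {A} → ILX⊢ X A → ILX⊢ X (□ A)

FmSet : Set₁
FmSet = Fm → Set

data _∣_⊢_ (X : Schemata) (Γ : FmSet) : Fm → Set where
  hyp : ∀ {A} → Γ A → X ∣ Γ ⊢ A
  thm : ∀ {A} → ILX⊢ X A → X ∣ Γ ⊢ A
  mp  : ∀ {A B} → X ∣ Γ ⊢ (A ⇒ B) → X ∣ Γ ⊢ A → X ∣ Γ ⊢ B

Consistent : Schemata → FmSet → Set
Consistent X Γ = ¬ (X ∣ Γ ⊢ ⊥')

_⊆_ : FmSet → FmSet → Set
Γ ⊆ Δ = ∀ {A} → Γ A → Δ A

MaxCon : Schemata → FmSet → Set₁
MaxCon X Γ = Consistent X Γ × ((Δ : FmSet) → Γ ⊆ Δ → Consistent X Δ → Δ ⊆ Γ)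

_≺[_]_ : FmSet → Fm → FmSet → Set
Γ ≺[ C ] Δ = ∀ E → Γ (E ▷ C) → Δ (~ E) × Δ (□ (~ E))

module Submission where

-- Put N D := P ∧ ¬(D ∨ ◇D). By induction on derivations, anything derivable from
-- {P} ∪ {¬E, □¬E | E ▷ B ∈ Γ} is implied by some N D with Γ ⊢ D ▷ B: the hypotheses
-- ¬E, □¬E are covered by D := E, and modus ponens by the disjunction of the two D's,
-- which J3 keeps below B. So if this set is inconsistent, then ⊢ P → D ∨ ◇D, and
-- J5 and J3 give Γ ⊢ P ▷ B. Taking P := A ∧ □¬A, which A interprets by Löb's axiom,
-- the set is consistent whenever ¬(A ▷ B) ∈ Γ, and any maximal consistent
-- extension of it (Lindenbaum) is the required Δ.

open import Defs
open import Data.Bool using (Bool; true; false; not; _∨_; _∧_; T)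
open import Data.Bool.Properties using (T-≡; T-∧)
open import Data.Empty using (⊥-elim)
open import Data.Fin using (Fin; zero; suc; #_)
open import Data.List using (List; []; _∷_; [_]; _++_; foldl; map; cartesianProductWith)
open import Data.List.Membership.Propositional using (_∈_)
open import Data.List.Membership.Propositional.Properties
  using (∈-++⁺ˡ; ∈-++⁺ʳ; ∈-map⁺; ∈-cartesianProductWith⁺)
open import Data.List.Relation.Unary.Any using (here; there)
open import Data.Nat using (ℕ; zero; suc; _≤_; _<?_; _≤′_; ≤′-refl; ≤′-step; _⊔_)
open import Data.Nat.Properties using (≤⇒≤′; m≤m⊔n; m≤n⊔m)
open import Data.Product using (Σ; ∃-syntax; _×_; _,_; proj₁; proj₂)
open import Data.Sum using (_⊎_; inj₁; inj₂)
open import Data.Vec as Vec using (Vec; []; _∷_; lookup)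
open import Data.Vec.Properties using (lookup-map)
open import Function using (_∘_)
open import Function.Bundles using (Equivalence)
open import Relation.Binary.PropositionalEquality using (_≡_; refl; sym; trans; cong₂)
open import Relation.Nullary using (¬_; yes; no)
open import Relation.Nullary.Decidable using (True; ¬¬-excluded-middle)

private
  variable
    k : ℕ
    X : Schemata
    Γ Δ S : FmSet
    A B C D E P Q R : Fm

-- Propositional skeletons: tautologies checked by truth tables over their atoms

infixr 6 _⇒ₛ_
infix 10 #ₛ_
infix 8 ~ₛ_
infixr 7 _∧ₛ_ _∨ₛ_

data Skeleton (k : ℕ) : Set where
  atom : Fin k → Skeleton k
  ⊥ₛ   : Skeleton k
  _⇒ₛ_ : Skeleton k → Skeleton k → Skeleton k

#ₛ_ : ∀ m {k} {m<k : True (m <? k)} → Skeleton k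
#ₛ_ m {m<k = m<k} = atom ((# m) {m<n = m<k})

~ₛ_ : Skeleton k → Skeleton k
~ₛ S = S ⇒ₛ ⊥ₛ

_∧ₛ_ _∨ₛ_ : Skeleton k → Skeleton k → Skeleton k
S ∧ₛ S′ = ~ₛ (S ⇒ₛ ~ₛ S′)
S ∨ₛ S′ = ~ₛ S ⇒ₛ S′

_⟨_⟩ : Skeleton k → Vec Fm k → Fm
atom i ⟨ σ ⟩ = lookup σ i
⊥ₛ ⟨ σ ⟩ = ⊥'
(S ⇒ₛ S′) ⟨ σ ⟩ = S ⟨ σ ⟩ ⇒ S′ ⟨ σ ⟩

evalₛ : Vec Bool k → Skeleton k → Bool
evalₛ ρ (atom i) = lookup ρ i
evalₛ ρ ⊥ₛ = false
evalₛ ρ (S ⇒ₛ S′) = not (evalₛ ρ S) ∨ evalₛ ρ S′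

eval-⟨⟩ : ∀ v (S : Skeleton k) σ → eval v (S ⟨ σ ⟩) ≡ evalₛ (Vec.map (eval v) σ) S
eval-⟨⟩ v (atom i) σ = sym (lookup-map i (eval v) σ)
eval-⟨⟩ v ⊥ₛ σ = refl
eval-⟨⟩ v (S ⇒ₛ S′) σ = cong₂ (λ b b′ → not b ∨ b′) (eval-⟨⟩ v S σ) (eval-⟨⟩ v S′ σ)

everywhere : ∀ k → (Vec Bool k → Bool) → Bool
everywhere zero g = g []
everywhere (suc k) g = everywhere k (g ∘ (true ∷_)) ∧ everywhere k (g ∘ (false ∷_))

everywhere-sound : ∀ k g → T (everywhere k g) → ∀ ρ → T (g ρ)
everywhere-sound zero g holds [] = holds
everywhere-sound (suc k) g holds (true ∷ ρ) =
  everywhere-sound k _ (proj₁ (Equivalence.to T-∧ holds)) ρ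
everywhere-sound (suc k) g holds (false ∷ ρ) =
  everywhere-sound k _ (proj₂ (Equivalence.to T-∧ holds)) ρ

Valid : Skeleton k → Set
Valid {k} S = T (everywhere k (λ ρ → evalₛ ρ S))

valid⇒Taut : (S : Skeleton k) → Valid S → ∀ σ → Taut (S ⟨ σ ⟩)
valid⇒Taut S valid σ v =
  trans (eval-⟨⟩ v S σ) (Equivalence.to T-≡ (everywhere-sound _ _ valid (Vec.map (eval v) σ)))

tautology : (S : Skeleton k) {valid : Valid S} (σ : Vec Fm k) → ILX⊢ X (S ⟨ σ ⟩)
tautology S {valid} σ = taut (valid⇒Taut S valid σ)

⇒-trans : ILX⊢ X (P ⇒ Q) → ILX⊢ X (Q ⇒ R) → ILX⊢ X (P ⇒ R)
⇒-trans {P = P} {Q} {R} p q =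
  mp (mp (tautology ((#ₛ 0 ⇒ₛ #ₛ 1) ⇒ₛ (#ₛ 1 ⇒ₛ #ₛ 2) ⇒ₛ #ₛ 0 ⇒ₛ #ₛ 2)
                    (P ∷ Q ∷ R ∷ [])) p) q

⇒-mp : ILX⊢ X (P ⇒ Q ⇒ R) → ILX⊢ X (P ⇒ Q) → ILX⊢ X (P ⇒ R)
⇒-mp {P = P} {Q} {R} p q =
  mp (mp (tautology ((#ₛ 0 ⇒ₛ #ₛ 1 ⇒ₛ #ₛ 2) ⇒ₛ (#ₛ 0 ⇒ₛ #ₛ 1) ⇒ₛ #ₛ 0 ⇒ₛ #ₛ 2)
                    (P ∷ Q ∷ R ∷ [])) p) q

□-mono : ILX⊢ X (P ⇒ Q) → ILX⊢ X (□ P ⇒ □ Q)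
□-mono p = mp K (nec p)

∧-intro : X ∣ Γ ⊢ P → X ∣ Γ ⊢ Q → X ∣ Γ ⊢ (P ∧' Q)
∧-intro {P = P} {Q = Q} p q =
  mp (mp (thm (tautology (#ₛ 0 ⇒ₛ #ₛ 1 ⇒ₛ #ₛ 0 ∧ₛ #ₛ 1) (P ∷ Q ∷ []))) p) q

∧-elimˡ : X ∣ Γ ⊢ (P ∧' Q) → X ∣ Γ ⊢ P
∧-elimˡ {P = P} {Q = Q} p = mp (thm (tautology (#ₛ 0 ∧ₛ #ₛ 1 ⇒ₛ #ₛ 0) (P ∷ Q ∷ []))) p

∧-elimʳ : X ∣ Γ ⊢ (P ∧' Q) → X ∣ Γ ⊢ Q
∧-elimʳ {P = P} {Q = Q} p = mp (thm (tautology (#ₛ 0 ∧ₛ #ₛ 1 ⇒ₛ #ₛ 1) (P ∷ Q ∷ []))) p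

⇒▷ : ILX⊢ X (P ⇒ Q) → X ∣ Γ ⊢ (P ▷ Q)
⇒▷ p = thm (mp J1 (nec p))

▷-trans : X ∣ Γ ⊢ (P ▷ Q) → X ∣ Γ ⊢ (Q ▷ R) → X ∣ Γ ⊢ (P ▷ R)
▷-trans p q = mp (thm J2) (∧-intro p q)

▷-∨ : X ∣ Γ ⊢ (P ▷ R) → X ∣ Γ ⊢ (Q ▷ R) → X ∣ Γ ⊢ ((P ∨' Q) ▷ R)
▷-∨ p q = mp (thm J3) (∧-intro p q)

⊥▷ : X ∣ Γ ⊢ (⊥' ▷ P)
⊥▷ {P = P} = ⇒▷ (tautology (⊥ₛ ⇒ₛ #ₛ 0) (P ∷ []))

▷-∨◇ : X ∣ Γ ⊢ (P ▷ Q) → X ∣ Γ ⊢ ((P ∨' ◇ P) ▷ Q)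
▷-∨◇ p = ▷-∨ p (▷-trans (thm J5) p)

◇-löb : ILX⊢ X (◇ A ⇒ ◇ (A ∧' □ (~ A)))
◇-löb {A = A} =
  mp (tautology ((#ₛ 0 ⇒ₛ #ₛ 1) ⇒ₛ ~ₛ #ₛ 1 ⇒ₛ ~ₛ #ₛ 0)
                (□ (~ (A ∧' □ (~ A))) ∷ □ (~ A) ∷ []))
     (⇒-trans (□-mono (tautology (~ₛ (#ₛ 0 ∧ₛ #ₛ 1) ⇒ₛ #ₛ 1 ⇒ₛ ~ₛ #ₛ 0)
                                 (A ∷ □ (~ A) ∷ [])))
              L)

▷-löb : X ∣ Γ ⊢ (A ▷ (A ∧' □ (~ A)))
▷-löb {A = A} =
  ▷-trans (⇒▷ (tautology (#ₛ 0 ⇒ₛ (#ₛ 0 ∧ₛ #ₛ 1) ∨ₛ ~ₛ #ₛ 1) (A ∷ □ (~ A) ∷ [])))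
          (▷-∨ (⇒▷ (tautology (#ₛ 0 ⇒ₛ #ₛ 0) (A ∧' □ (~ A) ∷ [])))
               (▷-trans (⇒▷ ◇-löb) (thm J5)))

insert : Fm → FmSet → FmSet
insert P S A = A ≡ P ⊎ S A

weaken : Γ ⊆ Δ → X ∣ Γ ⊢ A → X ∣ Δ ⊢ A
weaken Γ⊆Δ (hyp h) = hyp (Γ⊆Δ h)
weaken Γ⊆Δ (thm t) = thm t
weaken Γ⊆Δ (mp d e) = mp (weaken Γ⊆Δ d) (weaken Γ⊆Δ e)

cut : (∀ {A} → Γ A → X ∣ Δ ⊢ A) → X ∣ Γ ⊢ C → X ∣ Δ ⊢ C
cut Γ⊢ (hyp h) = Γ⊢ h
cut Γ⊢ (thm t) = thm t
cut Γ⊢ (mp d e) = mp (cut Γ⊢ d) (cut Γ⊢ e)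

maxCon-closed : MaxCon X Γ → X ∣ Γ ⊢ A → Γ A
maxCon-closed {X} {Γ} {A} (Γ-con , Γ-max) Γ⊢A =
  Γ-max (insert A Γ) inj₂ (Γ-con ∘ cut derivable) (inj₁ refl)
  where
  derivable : ∀ {C} → insert A Γ C → X ∣ Γ ⊢ C
  derivable (inj₁ refl) = Γ⊢A
  derivable (inj₂ h) = hyp h

-- Lindenbaum's lemma

chain-mono : {F : ℕ → FmSet} → (∀ n → F n ⊆ F (suc n)) → ∀ {m n} → m ≤ n → F m ⊆ F n
chain-mono {F} step m≤n = go (≤⇒≤′ m≤n)
  where
  go : ∀ {m n} → m ≤′ n → F m ⊆ F n
  go ≤′-refl = λ h → h
  go (≤′-step m≤′n) = step _ ∘ go m≤′n

formulas : ℕ → List Fm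
formulas zero = [ ⊥' ]
formulas (suc n) =
  var n ∷ fs ++ cartesianProductWith _⇒_ fs fs ++ map □ fs ++ cartesianProductWith _▷_ fs fs
  where
  fs : List Fm
  fs = formulas n

formulas-mono : ∀ {m n} → m ≤ n → ∀ {A} → A ∈ formulas m → A ∈ formulas n
formulas-mono = chain-mono (λ _ → there ∘ ∈-++⁺ˡ)

⇒∈formulas : ∀ {n} → A ∈ formulas n → B ∈ formulas n → (A ⇒ B) ∈ formulas (suc n)
⇒∈formulas {n = n} A∈ B∈ =
  there (∈-++⁺ʳ (formulas n) (∈-++⁺ˡ (∈-cartesianProductWith⁺ _⇒_ A∈ B∈)))

□∈formulas : ∀ {n} → A ∈ formulas n → □ A ∈ formulas (suc n)
□∈formulas {n = n} A∈ =
  there (∈-++⁺ʳ fs (∈-++⁺ʳ (cartesianProductWith _⇒_ fs fs) (∈-++⁺ˡ (∈-map⁺ □ A∈))))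
  where
  fs : List Fm
  fs = formulas n

▷∈formulas : ∀ {n} → A ∈ formulas n → B ∈ formulas n → (A ▷ B) ∈ formulas (suc n)
▷∈formulas {n = n} A∈ B∈ =
  there (∈-++⁺ʳ fs (∈-++⁺ʳ (cartesianProductWith _⇒_ fs fs) (∈-++⁺ʳ (map □ fs)
    (∈-cartesianProductWith⁺ _▷_ A∈ B∈))))
  where
  fs : List Fm
  fs = formulas n

∈formulas-⊔ : (∀ {n} → A ∈ formulas n → B ∈ formulas n → C ∈ formulas (suc n))
            → ∃[ n ] A ∈ formulas n → ∃[ n ] B ∈ formulas n → ∃[ n ] C ∈ formulas n
∈formulas-⊔ ∈suc (m , A∈) (n , B∈) =
  suc (m ⊔ n) , ∈suc (formulas-mono (m≤m⊔n m n) A∈) (formulas-mono (m≤n⊔m m n) B∈)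

formulas-complete : ∀ A → ∃[ n ] A ∈ formulas n
formulas-complete (var n) = suc n , here refl
formulas-complete ⊥' = zero , here refl
formulas-complete (A ⇒ B) = ∈formulas-⊔ ⇒∈formulas (formulas-complete A) (formulas-complete B)
formulas-complete (□ A) with formulas-complete A
... | n , A∈ = suc n , □∈formulas A∈
formulas-complete (A ▷ B) = ∈formulas-⊔ ▷∈formulas (formulas-complete A) (formulas-complete B)

module Lindenbaum (X : Schemata) where

  -- Membership of the new formula is guarded by a proposition rather than decided,
  -- so no excluded middle is needed to define the extension.
  extend : FmSet → Fm → FmSet
  extend S A C = S C ⊎ (C ≡ A × Consistent X (insert A S))

  extendAll : FmSet → List Fm → FmSet
  extendAll = foldl extend

  ⊆-extendAll : ∀ S As → S ⊆ extendAll S As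
  ⊆-extendAll S [] h = h
  ⊆-extendAll S (A ∷ As) h = ⊆-extendAll (extend S A) As (inj₁ h)

  -- Excluded middle is available under the double negation of the goal ⊥.
  extend-consistent : ∀ S A → Consistent X S → Consistent X (extend S A)
  extend-consistent S A S-con ⊢⊥ = ¬¬-excluded-middle λ
    { (yes S,A-con) → S,A-con (weaken extend⊆insert ⊢⊥)
    ; (no S,A-incon) → S-con (weaken (extend⊆ S,A-incon) ⊢⊥)
    }
    where
    extend⊆insert : extend S A ⊆ insert A S
    extend⊆insert (inj₁ h) = inj₂ h
    extend⊆insert (inj₂ (refl , _)) = inj₁ refl
    extend⊆ : ¬ Consistent X (insert A S) → extend S A ⊆ S
    extend⊆ _ (inj₁ h) = h
    extend⊆ S,A-incon (inj₂ (_ , S,A-con)) = ⊥-elim (S,A-incon S,A-con)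

  extendAll-consistent : ∀ S As → Consistent X S → Consistent X (extendAll S As)
  extendAll-consistent S [] S-con = S-con
  extendAll-consistent S (A ∷ As) S-con =
    extendAll-consistent (extend S A) As (extend-consistent S A S-con)

  extendAll-maximal : ∀ S As {A} (U : FmSet) → A ∈ As → extendAll S As ⊆ U → U A → Consistent X U
                      → extendAll S As A
  extendAll-maximal S (A ∷ As) U (here refl) ⊆U A∈U U-con =
    ⊆-extendAll (extend S A) As (inj₂ (refl , U-con ∘ weaken S,A⊆U))
    where
    S,A⊆U : insert A S ⊆ U
    S,A⊆U (inj₁ refl) = A∈U
    S,A⊆U (inj₂ h) = ⊆U (⊆-extendAll (extend S A) As (inj₁ h))
  extendAll-maximal S (_ ∷ As) U (there A∈As) ⊆U A∈U U-con =
    extendAll-maximal (extend S _) As U A∈As ⊆U A∈U U-con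

  stage : FmSet → ℕ → FmSet
  stage Δ₀ zero = Δ₀
  stage Δ₀ (suc n) = extendAll (stage Δ₀ n) (formulas n)

  limit : FmSet → FmSet
  limit Δ₀ A = ∃[ n ] stage Δ₀ n A

  stage-mono : ∀ Δ₀ {m n} → m ≤ n → stage Δ₀ m ⊆ stage Δ₀ n
  stage-mono Δ₀ = chain-mono (λ n → ⊆-extendAll (stage Δ₀ n) (formulas n))

  derivation-in-stage : ∀ Δ₀ → X ∣ limit Δ₀ ⊢ C → ∃[ n ] X ∣ stage Δ₀ n ⊢ C
  derivation-in-stage Δ₀ (hyp (n , h)) = n , hyp h
  derivation-in-stage Δ₀ (thm t) = zero , thm t
  derivation-in-stage Δ₀ (mp d e) with derivation-in-stage Δ₀ d | derivation-in-stage Δ₀ e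
  ... | m , d′ | n , e′ =
    m ⊔ n , mp (weaken (stage-mono Δ₀ (m≤m⊔n m n)) d′) (weaken (stage-mono Δ₀ (m≤n⊔m m n)) e′)

  stage-consistent : ∀ Δ₀ → Consistent X Δ₀ → ∀ n → Consistent X (stage Δ₀ n)
  stage-consistent Δ₀ Δ₀-con zero = Δ₀-con
  stage-consistent Δ₀ Δ₀-con (suc n) =
    extendAll-consistent (stage Δ₀ n) (formulas n) (stage-consistent Δ₀ Δ₀-con n)

  limit-maxCon : ∀ Δ₀ → Consistent X Δ₀ → MaxCon X (limit Δ₀)
  limit-maxCon Δ₀ Δ₀-con = consistent , maximal
    where
    consistent : Consistent X (limit Δ₀)
    consistent ⊢⊥ with derivation-in-stage Δ₀ ⊢⊥
    ... | n , ⊢⊥′ = stage-consistent Δ₀ Δ₀-con n ⊢⊥′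
    maximal : ∀ U → limit Δ₀ ⊆ U → Consistent X U → U ⊆ limit Δ₀
    maximal U ⊆U U-con {A} A∈U with formulas-complete A
    ... | n , A∈ =
      suc n , extendAll-maximal (stage Δ₀ n) (formulas n) U A∈ (⊆U ∘ (suc n ,_)) A∈U U-con

lindenbaum : Consistent X S → Σ FmSet (λ Δ → MaxCon X Δ × S ⊆ Δ)
lindenbaum {X} {S} S-con = limit S , limit-maxCon S S-con , (zero ,_)
  where open Lindenbaum X

-- B-critical successors

criticalCore : FmSet → Fm → FmSet
criticalCore Γ B F = Σ Fm λ E → Γ (E ▷ B) × (F ≡ ~ E ⊎ F ≡ □ (~ E))

criticalCore⊆⇒≺ : criticalCore Γ B ⊆ Δ → Γ ≺[ B ] Δ
criticalCore⊆⇒≺ core⊆Δ E E▷B = core⊆Δ (E , E▷B , inj₁ refl) , core⊆Δ (E , E▷B , inj₂ refl)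

module CriticalExtension (X : Schemata) (Γ : FmSet) (B P : Fm) where

  N : Fm → Fm
  N D = P ∧' (~ (D ∨' ◇ D))

  N-antitone : ILX⊢ X (D ⇒ E) → ILX⊢ X (N E ⇒ N D)
  N-antitone {D} {E} D⇒E =
    mp (mp (tautology ((#ₛ 0 ⇒ₛ #ₛ 1) ⇒ₛ (#ₛ 2 ⇒ₛ #ₛ 3)
                          ⇒ₛ #ₛ 4 ∧ₛ ~ₛ (#ₛ 1 ∨ₛ ~ₛ #ₛ 2) ⇒ₛ #ₛ 4 ∧ₛ ~ₛ (#ₛ 0 ∨ₛ ~ₛ #ₛ 3))
                      (D ∷ E ∷ □ (~ E) ∷ □ (~ D) ∷ P ∷ []))
           D⇒E)
       (□-mono (mp (tautology ((#ₛ 0 ⇒ₛ #ₛ 1) ⇒ₛ ~ₛ #ₛ 1 ⇒ₛ ~ₛ #ₛ 0) (D ∷ E ∷ [])) D⇒E))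

  record Supported (C : Fm) : Set where
    constructor supported
    field
      support : Fm
      support▷B : X ∣ Γ ⊢ (support ▷ B)
      N⇒C : ILX⊢ X (N support ⇒ C)

  derivation-supported : X ∣ insert P (criticalCore Γ B) ⊢ C → Supported C
  derivation-supported (hyp (inj₁ refl)) =
    supported ⊥' ⊥▷ (tautology (#ₛ 0 ∧ₛ #ₛ 1 ⇒ₛ #ₛ 0) (P ∷ ~ (⊥' ∨' ◇ ⊥') ∷ []))
  derivation-supported (hyp (inj₂ (E , E▷B , inj₁ refl))) =
    supported E (hyp E▷B)
      (tautology (#ₛ 0 ∧ₛ ~ₛ (#ₛ 1 ∨ₛ ~ₛ #ₛ 2) ⇒ₛ ~ₛ #ₛ 1) (P ∷ E ∷ □ (~ E) ∷ []))
  derivation-supported (hyp (inj₂ (E , E▷B , inj₂ refl))) =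
    supported E (hyp E▷B)
      (tautology (#ₛ 0 ∧ₛ ~ₛ (#ₛ 1 ∨ₛ ~ₛ #ₛ 2) ⇒ₛ #ₛ 2) (P ∷ E ∷ □ (~ E) ∷ []))
  derivation-supported {C} (thm ⊢C) =
    supported ⊥' ⊥▷ (mp (tautology (#ₛ 0 ⇒ₛ #ₛ 1 ⇒ₛ #ₛ 0) (C ∷ N ⊥' ∷ [])) ⊢C)
  derivation-supported (mp d e) with derivation-supported d | derivation-supported e
  ... | supported D₁ D₁▷B N₁⇒ | supported D₂ D₂▷B N₂⇒ =
    supported (D₁ ∨' D₂) (▷-∨ D₁▷B D₂▷B)
      (⇒-mp (⇒-trans (N-antitone (tautology (#ₛ 0 ⇒ₛ #ₛ 0 ∨ₛ #ₛ 1) (D₁ ∷ D₂ ∷ []))) N₁⇒)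
            (⇒-trans (N-antitone (tautology (#ₛ 1 ⇒ₛ #ₛ 0 ∨ₛ #ₛ 1) (D₁ ∷ D₂ ∷ []))) N₂⇒))

  inconsistent⇒▷ : X ∣ insert P (criticalCore Γ B) ⊢ ⊥' → X ∣ Γ ⊢ (P ▷ B)
  inconsistent⇒▷ ⊢⊥ with derivation-supported ⊢⊥
  ... | supported D D▷B N⇒⊥ =
    ▷-trans (⇒▷ (mp (tautology ((#ₛ 0 ∧ₛ ~ₛ (#ₛ 1 ∨ₛ ~ₛ #ₛ 2) ⇒ₛ ⊥ₛ)
                                  ⇒ₛ #ₛ 0 ⇒ₛ #ₛ 1 ∨ₛ ~ₛ #ₛ 2)
                               (P ∷ D ∷ □ (~ D) ∷ []))
                    N⇒⊥))
            (▷-∨◇ D▷B)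

critical-consistent : Consistent X Γ → Γ (~ (A ▷ B))
                      → Consistent X (insert (A ∧' □ (~ A)) (criticalCore Γ B))
critical-consistent {X} {Γ} {A} {B} Γ-con ¬A▷B ⊢⊥ =
  Γ-con (mp (hyp ¬A▷B) (▷-trans ▷-löb (inconsistent⇒▷ ⊢⊥)))
  where open CriticalExtension X Γ B (A ∧' □ (~ A))

lemma4p17 : (X : Schemata) (Γ : FmSet) (A B : Fm) → MaxCon X Γ → Γ (~ (A ▷ B))
    → Σ FmSet (λ Δ → MaxCon X Δ × Γ ≺[ B ] Δ × Δ A × Δ (□ (~ A)))
lemma4p17 X Γ A B (Γ-con , _) ¬A▷B with lindenbaum (critical-consistent Γ-con ¬A▷B)
... | Δ , Δ-maxCon , Δ₀⊆Δ =
  Δ , Δ-maxCon , criticalCore⊆⇒≺ {Γ = Γ} {B = B} (Δ₀⊆Δ ∘ inj₂)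
    , maxCon-closed Δ-maxCon (∧-elimˡ A∧□¬A) , maxCon-closed Δ-maxCon (∧-elimʳ A∧□¬A)
  where
  A∧□¬A : X ∣ Δ ⊢ (A ∧' □ (~ A))
  A∧□¬A = hyp (Δ₀⊆Δ (inj₁ refl))
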